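{- Let $G=(V,E)$ be a graph and let $\mathrm{ori}(G)$ denote the set of the $2^{|E|}$ digraphs obtained by choosing a direction for each edge of $G$. Then $$\frac{1}{2^{|E|}}\sum_{\vec G\in\mathrm{ori}(G)} B_{\vec G}(q,y,z)=P_G\!\left(q,\frac{y+z}{2}\right).$$
   Context: Graphs and digraphs are finite and may have loops and multiple edges/arcs. For a digraph $D=(V,A)$, the $B$-polynomial $B_D(q,y,z)$ is the unique polynomial in $q,y,z$ such that for every positive integer $q$, $B_D(q,y,z)=\sum_{f:V\to\{1,\dots,q\}} y^{\#\{(u,v)\in A:\ f(v)>f(u)\}}\, z^{\#\{(u,v)\in A:\ f(v)<f(u)\}}$. For a graph $G=(V,E)$, the Potts polynomial $P_G(q,y)$ is the unique polynomial such that for every positive integer $q$, $P_G(q,y)=\sum_{f:V\to\{1,\dots,q\}} y^{\#\{\{u,v\}\in E:\ f(u)\neq f(v)\}}$. -}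

module Defs where

open import Data.Nat using (ℕ; zero; suc)
open import Data.Fin using (Fin; toℕ)
open import Data.Bool using (Bool; true; false; if_then_else_)
open import Data.Product using (_×_; _,_)
open import Data.List using (List; []; _∷_; map; concatMap; length; foldr)
open import Data.Vec using (Vec; []; _∷_; lookup)
open import Data.Rational using (ℚ; 0ℚ; 1ℚ; _+_; _*_)
open import Relation.Nullary.Decidable using (does)
import Data.Nat as ℕ
import Data.Fin as F

_^ℚ_ : ℚ → ℕ → ℚ
x ^ℚ zero = 1ℚ
x ^ℚ suc k = x * (x ^ℚ k)

sumℚ : List ℚ → ℚ
sumℚ = foldr _+_ 0ℚ

-- A (multi)graph on vertex set Fin n: a list of edges {u,v}, each given by
-- its two ends (loops and parallel edges allowed).  A digraph on Fin n is a
-- list of arcs (u , v), meaning an arc from u to v.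
Edges : ℕ → Set
Edges n = List (Fin n × Fin n)

Arcs : ℕ → Set
Arcs n = List (Fin n × Fin n)

-- ori(G): the 2^|E| digraphs obtained by choosing a direction for each edge
-- (as a list, with multiplicity; a loop yields the same arc both ways).
ori : ∀ {n} → Edges n → List (Arcs n)
ori [] = [] ∷ []
ori ((u , v) ∷ es) =
  concatMap (λ D → ((u , v) ∷ D) ∷ ((v , u) ∷ D) ∷ []) (ori es)

-- all maps f : V → {1,…,q}, with V = Fin n and {1,…,q} represented by Fin q
colourings : (n q : ℕ) → List (Vec (Fin q) n)
colourings zero q = [] ∷ []
colourings (suc n) q =
  concatMap (λ f → map (λ c → c ∷ f) (Data.List.allFin q)) (colourings n q)

count : ∀ {A : Set} → (A → Bool) → List A → ℕ
count p [] = 0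
count p (x ∷ xs) = if p x then suc (count p xs) else count p xs

B : ∀ {n} → Arcs n → (q : ℕ) → ℚ → ℚ → ℚ
B {n} D q y z = sumℚ (map term (colourings n q))
  where
  term : Vec (Fin q) n → ℚ
  term f =
    (y ^ℚ count (λ { (u , v) → does (lookup f u F.<? lookup f v) }) D)
    * (z ^ℚ count (λ { (u , v) → does (lookup f v F.<? lookup f u) }) D)

P : ∀ {n} → Edges n → (q : ℕ) → ℚ → ℚ
P {n} es q y = sumℚ (map term (colourings n q))
  where
  term : Vec (Fin q) n → ℚ
  term f = y ^ℚ count (λ { (u , v) → Data.Bool.not (does (lookup f u F.≟ lookup f v)) }) es

-- Fix a colouring f.  The weight of an orientation is a product over its arcs,
-- and choosing an orientation means choosing one of the two arcs of each edge
-- independently, so the average weight over ori(G) is the product over the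
-- edges of the average of the two arc weights.  For an edge whose ends get
-- colours a < b this average is (y·1 + 1·z)/2, and for a = b it is 1; that is
-- ((y + z)/2)^[a ≠ b], the Potts weight of the edge.  Summing over f gives the
-- theorem.
module Submission where

open import Defs
open import Data.Nat using (ℕ; _≤_)
open import Data.Bool using (Bool; true; false; if_then_else_; not)
open import Data.Product using (_×_; _,_)
open import Data.Fin using (Fin)
import Data.Fin as F
import Data.Fin.Properties as FP
open import Data.List using (List; []; _∷_; _++_; length; map; concatMap; foldr)
open import Data.List.Properties using (map-++; map-cong)
open import Data.Vec using (Vec; lookup)
open import Data.Rational using (ℚ; ½; _+_; _*_; 0ℚ; 1ℚ)
open import Data.Rational.Properties
  using (+-identityˡ; +-assoc; *-identityˡ; *-zeroʳ; *-distribˡ-+)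
open import Data.Rational.Solver using (module +-*-Solver)
open import Relation.Binary.Definitions using (tri<; tri≈; tri>)
open import Relation.Binary.PropositionalEquality
open import Relation.Nullary.Decidable using (does; dec-true; dec-false)

open +-*-Solver
open ≡-Reasoning

sumℚ-++ : (xs ys : List ℚ) → sumℚ (xs ++ ys) ≡ sumℚ xs + sumℚ ys
sumℚ-++ []       ys = sym (+-identityˡ _)
sumℚ-++ (x ∷ xs) ys = trans (cong (x +_) (sumℚ-++ xs ys)) (sym (+-assoc x _ _))

sumℚ-concatMap : ∀ {A C : Set} (g : C → ℚ) (h : A → List C) (xs : List A) →
  sumℚ (map g (concatMap h xs)) ≡ sumℚ (map (λ a → sumℚ (map g (h a))) xs)
sumℚ-concatMap g h []       = refl
sumℚ-concatMap g h (x ∷ xs) = begin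
  sumℚ (map g (h x ++ concatMap h xs))           ≡⟨ cong sumℚ (map-++ g (h x) (concatMap h xs)) ⟩
  sumℚ (map g (h x) ++ map g (concatMap h xs))   ≡⟨ sumℚ-++ (map g (h x)) _ ⟩
  sumℚ (map g (h x)) + sumℚ (map g (concatMap h xs)) ≡⟨ cong (sumℚ (map g (h x)) +_) (sumℚ-concatMap g h xs) ⟩
  sumℚ (map g (h x)) + sumℚ (map (λ a → sumℚ (map g (h a))) xs) ∎

sumℚ-*ˡ : ∀ {A : Set} (c : ℚ) (g : A → ℚ) (xs : List A) →
  sumℚ (map (λ a → c * g a) xs) ≡ c * sumℚ (map g xs)
sumℚ-*ˡ c g []       = sym (*-zeroʳ c)
sumℚ-*ˡ c g (x ∷ xs) = trans (cong (c * g x +_) (sumℚ-*ˡ c g xs)) (sym (*-distribˡ-+ c _ _))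

sumℚ-+ : ∀ {A : Set} (g h : A → ℚ) (xs : List A) →
  sumℚ (map (λ a → g a + h a) xs) ≡ sumℚ (map g xs) + sumℚ (map h xs)
sumℚ-+ g h []       = refl
sumℚ-+ g h (x ∷ xs) = trans (cong (g x + h x +_) (sumℚ-+ g h xs)) (interchange (g x) (h x) _ _)
  where
  interchange : ∀ a b c d → a + b + (c + d) ≡ a + c + (b + d)
  interchange = solve 4 (λ a b c d → (a :+ b) :+ (c :+ d) := (a :+ c) :+ (b :+ d)) refl

sumℚ-zero : ∀ {A : Set} (xs : List A) → sumℚ (map (λ _ → 0ℚ) xs) ≡ 0ℚ
sumℚ-zero []       = refl
sumℚ-zero (_ ∷ xs) = trans (+-identityˡ _) (sumℚ-zero xs)

sumℚ-swap : ∀ {A C : Set} (T : A → C → ℚ) (xs : List A) (ys : List C) →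
  sumℚ (map (λ a → sumℚ (map (T a) ys)) xs) ≡ sumℚ (map (λ c → sumℚ (map (λ a → T a c) xs)) ys)
sumℚ-swap T []       ys = sym (sumℚ-zero ys)
sumℚ-swap T (x ∷ xs) ys =
  trans (cong (sumℚ (map (T x) ys) +_) (sumℚ-swap T xs ys))
        (sym (sumℚ-+ (T x) (λ c → sumℚ (map (λ a → T a c) xs)) ys))

prodℚ : List ℚ → ℚ
prodℚ = foldr _*_ 1ℚ

prodℚ-* : ∀ {A : Set} (g h : A → ℚ) (xs : List A) →
  prodℚ (map (λ a → g a * h a) xs) ≡ prodℚ (map g xs) * prodℚ (map h xs)
prodℚ-* g h []       = refl
prodℚ-* g h (x ∷ xs) = trans (cong (g x * h x *_) (prodℚ-* g h xs)) (interchange (g x) (h x) _ _)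
  where
  interchange : ∀ a b c d → a * b * (c * d) ≡ a * c * (b * d)
  interchange = solve 4 (λ a b c d → (a :* b) :* (c :* d) := (a :* c) :* (b :* d)) refl

^ℚ-length : ∀ {A : Set} (x : ℚ) (xs : List A) → x ^ℚ length xs ≡ prodℚ (map (λ _ → x) xs)
^ℚ-length x []       = refl
^ℚ-length x (_ ∷ xs) = cong (x *_) (^ℚ-length x xs)

_^ᵇ_ : ℚ → Bool → ℚ
x ^ᵇ b = if b then x else 1ℚ

^ℚ-count : ∀ {A : Set} (x : ℚ) (p : A → Bool) (xs : List A) →
  x ^ℚ count p xs ≡ prodℚ (map (λ a → x ^ᵇ p a) xs)
^ℚ-count x p []       = refl
^ℚ-count x p (a ∷ xs) with p a
... | true  = cong (x *_) (^ℚ-count x p xs)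
... | false = trans (^ℚ-count x p xs) (sym (*-identityˡ _))

sumℚ-ori-prodℚ : ∀ {n} (φ : Fin n × Fin n → ℚ) (es : Edges n) →
  sumℚ (map (λ D → prodℚ (map φ D)) (ori es))
    ≡ prodℚ (map (λ { (u , v) → φ (u , v) + φ (v , u) }) es)
sumℚ-ori-prodℚ φ []             = +-identityˡ 1ℚ
sumℚ-ori-prodℚ φ ((u , v) ∷ es) = begin
  sumℚ (map Π (concatMap (λ D → ((u , v) ∷ D) ∷ ((v , u) ∷ D) ∷ []) (ori es)))
    ≡⟨ sumℚ-concatMap Π _ (ori es) ⟩
  sumℚ (map (λ D → φ (u , v) * Π D + (φ (v , u) * Π D + 0ℚ)) (ori es))
    ≡⟨ cong sumℚ (map-cong (λ D → factor (φ (u , v)) (φ (v , u)) (Π D)) (ori es)) ⟩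
  sumℚ (map (λ D → (φ (u , v) + φ (v , u)) * Π D) (ori es))
    ≡⟨ sumℚ-*ˡ (φ (u , v) + φ (v , u)) Π (ori es) ⟩
  (φ (u , v) + φ (v , u)) * sumℚ (map Π (ori es))
    ≡⟨ cong ((φ (u , v) + φ (v , u)) *_) (sumℚ-ori-prodℚ φ es) ⟩
  (φ (u , v) + φ (v , u)) * prodℚ (map (λ { (u , v) → φ (u , v) + φ (v , u) }) es) ∎
  where
  Π : Arcs _ → ℚ
  Π D = prodℚ (map φ D)
  factor : ∀ a b p → a * p + (b * p + 0ℚ) ≡ (a + b) * p
  factor = solve 3 (λ a b p → a :* p :+ (b :* p :+ con 0ℚ) := (a :+ b) :* p) refl

module _ (y z : ℚ) where

  arcWeight : ∀ {q} → Fin q → Fin q → ℚ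
  arcWeight a b = y ^ᵇ does (a F.<? b) * z ^ᵇ does (b F.<? a)

  average-arcWeight : ∀ {q} (a b : Fin q) →
    ½ * (arcWeight a b + arcWeight b a) ≡ ((y + z) * ½) ^ᵇ not (does (a F.≟ b))
  average-arcWeight a b with FP.<-cmp a b
  ... | tri< a<b a≢b _
    rewrite dec-true (a F.<? b) a<b | dec-false (b F.<? a) (FP.<-asym a<b) | dec-false (a F.≟ b) a≢b
    = solve 2 (λ y z → con ½ :* (y :* con 1ℚ :+ con 1ℚ :* z) := (y :+ z) :* con ½) refl y z
  ... | tri> _ a≢b b<a
    rewrite dec-true (b F.<? a) b<a | dec-false (a F.<? b) (FP.<-asym b<a) | dec-false (a F.≟ b) a≢b
    = solve 2 (λ y z → con ½ :* (con 1ℚ :* z :+ y :* con 1ℚ) := (y :+ z) :* con ½) refl y z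
  ... | tri≈ _ refl _
    rewrite dec-false (a F.<? a) (FP.<-irrefl refl) | dec-true (a F.≟ a) refl
    = refl

  module _ {n q : ℕ} (f : Vec (Fin q) n) where

    weight : Arcs n → ℚ
    weight D = y ^ℚ count (λ { (u , v) → does (lookup f u F.<? lookup f v) }) D
             * z ^ℚ count (λ { (u , v) → does (lookup f v F.<? lookup f u) }) D

    pottsWeight : Edges n → ℚ
    pottsWeight es = ((y + z) * ½) ^ℚ count (λ { (u , v) → not (does (lookup f u F.≟ lookup f v)) }) es

    weight-prodℚ : (D : Arcs n) →
      weight D ≡ prodℚ (map (λ { (u , v) → arcWeight (lookup f u) (lookup f v) }) D)
    weight-prodℚ D = begin
      weight D
        ≡⟨ cong₂ _*_ (^ℚ-count y _ D) (^ℚ-count z _ D) ⟩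
      prodℚ (map (λ { (u , v) → y ^ᵇ does (lookup f u F.<? lookup f v) }) D)
        * prodℚ (map (λ { (u , v) → z ^ᵇ does (lookup f v F.<? lookup f u) }) D)
        ≡⟨ sym (prodℚ-* _ _ D) ⟩
      prodℚ (map (λ { (u , v) → arcWeight (lookup f u) (lookup f v) }) D) ∎

    average-weight : (es : Edges n) →
      ½ ^ℚ length es * sumℚ (map weight (ori es)) ≡ pottsWeight es
    average-weight es = begin
      ½ ^ℚ length es * sumℚ (map weight (ori es))
        ≡⟨ cong₂ _*_ (^ℚ-length ½ es) (cong sumℚ (map-cong weight-prodℚ (ori es))) ⟩
      prodℚ (map (λ _ → ½) es) * sumℚ (map (λ D → prodℚ (map φ D)) (ori es))
        ≡⟨ cong (prodℚ (map (λ _ → ½) es) *_) (sumℚ-ori-prodℚ φ es) ⟩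
      prodℚ (map (λ _ → ½) es) * prodℚ (map (λ { (u , v) → φ (u , v) + φ (v , u) }) es)
        ≡⟨ sym (prodℚ-* _ _ es) ⟩
      prodℚ (map (λ { (u , v) → ½ * (φ (u , v) + φ (v , u)) }) es)
        ≡⟨ cong prodℚ (map-cong (λ { (u , v) → average-arcWeight (lookup f u) (lookup f v) }) es) ⟩
      prodℚ (map (λ { (u , v) → ((y + z) * ½) ^ᵇ not (does (lookup f u F.≟ lookup f v)) }) es)
        ≡⟨ sym (^ℚ-count _ _ es) ⟩
      pottsWeight es ∎
      where
      φ : Fin n × Fin n → ℚ
      φ (u , v) = arcWeight (lookup f u) (lookup f v)

proposition3p6 : (n : ℕ) (es : Edges n) (q : ℕ) → 1 ≤ q → (y z : ℚ) →
    (½ ^ℚ length es) * sumℚ (map (λ D → B D q y z) (ori es))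
      ≡ P es q ((y + z) * ½)
-- The identity holds for every q.
proposition3p6 n es q _ y z = begin
  ½ ^ℚ length es * sumℚ (map (λ D → sumℚ (map (λ f → weight y z f D) fs)) (ori es))
    ≡⟨ cong (½ ^ℚ length es *_) (sumℚ-swap (λ D f → weight y z f D) (ori es) fs) ⟩
  ½ ^ℚ length es * sumℚ (map (λ f → sumℚ (map (weight y z f) (ori es))) fs)
    ≡⟨ sym (sumℚ-*ˡ (½ ^ℚ length es) _ fs) ⟩
  sumℚ (map (λ f → ½ ^ℚ length es * sumℚ (map (weight y z f) (ori es))) fs)
    ≡⟨ cong sumℚ (map-cong (λ f → average-weight y z f es) fs) ⟩
  P es q ((y + z) * ½) ∎
  where
  fs : List (Vec (Fin q) n)
  fs = colourings n q
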